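{- For all integers $k \ge r \ge 3$, \[ k\,\beta_1(k-1,r-1) \le \alpha(k,r) \le (k-1)\,\beta_2(k,r-1). \]
   Context: All graphs are finite and simple. A $k$-partite graph comes with a fixed partition of its vertex set into $k$ parts (parts may be empty). An admissible non-edge is a non-adjacent pair of vertices in different parts. A $k$-partite graph is $K_r$-partite-saturated if it contains no $K_r$ but adding any admissible non-edge creates a copy of $K_r$. $\alpha(k,r)$ is the minimum of $e(X, V(G)\setminus X)$ over all pairs $(G,X)$ where $G$ is a $K_r$-partite-saturated $k$-partite graph and $X$ is an independent set of $G$ of size $k$ containing exactly one vertex from each part of $G$. For $k \ge r \ge 2$ and $1 \le i \le k-r+1$, $\beta_i(k,r)$ is the minimum number of vertices of a $K_r$-free $k$-partite graph such that, for every choice of $k-i$ of its parts, the subgraph induced by those parts contains a $K_{r-1}$ (i.e. deleting any $i$ parts does not destroy all copies of $K_{r-1}$). -}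

module Defs where

open import Data.Nat using (ℕ; zero; suc; _+_; _≤_)
open import Data.Bool using (Bool; true; false; _∧_; _∨_; not)
open import Data.Fin using (Fin; zero; suc; _≟_)
open import Data.Fin.Subset using (Subset; _∉_; ∣_∣)
open import Data.Product using (Σ; ∃; _×_; _,_)
open import Relation.Binary.PropositionalEquality using (_≡_; _≢_)
open import Relation.Nullary using (¬_)
open import Relation.Nullary.Decidable using (⌊_⌋)

sumFin : (m : ℕ) → (Fin m → ℕ) → ℕ
sumFin zero    f = 0
sumFin (suc m) f = f zero + sumFin m (λ i → f (suc i))

countFin : (m : ℕ) → (Fin m → Bool) → ℕ
countFin m p = sumFin m (λ i → if′ (p i))
  where
  if′ : Bool → ℕ
  if′ true  = 1
  if′ false = 0

anyFin : (m : ℕ) → (Fin m → Bool) → Bool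
anyFin zero    p = false
anyFin (suc m) p = p zero ∨ anyFin m (λ i → p (suc i))

-- A finite simple k-partite graph on vertex set Fin n, with a fixed
-- partition of the vertices into k (possibly empty) parts given by `part`;
-- every part is an independent set.
record KPartite (k : ℕ) : Set where
  field
    n       : ℕ
    part    : Fin n → Fin k
    adj     : Fin n → Fin n → Bool
    sym     : ∀ u v → adj u v ≡ adj v u
    irrefl  : ∀ v → adj v v ≡ false
    partite : ∀ u v → adj u v ≡ true → part u ≢ part v

HasClique : {n : ℕ} → (Fin n → Fin n → Bool) → ℕ → Set
HasClique {n} a r =
  Σ (Fin r → Fin n) λ f → ∀ i j → i ≢ j → a (f i) (f j) ≡ true

addEdge : {n : ℕ} → (Fin n → Fin n → Bool) → Fin n → Fin n → (Fin n → Fin n → Bool)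
addEdge a u v x y =
  a x y ∨ ((⌊ x ≟ u ⌋ ∧ ⌊ y ≟ v ⌋) ∨ (⌊ x ≟ v ⌋ ∧ ⌊ y ≟ u ⌋))

PartiteSaturated : {k : ℕ} → ℕ → KPartite k → Set
PartiteSaturated r G =
  ¬ HasClique adj r ×
  (∀ u v → part u ≢ part v → adj u v ≡ false → HasClique (addEdge adj u v) r)
  where open KPartite G

-- An independent set of size k containing exactly one vertex of each part:
-- given by the map sending each part i to its chosen vertex.
IndepTransversal : {k : ℕ} → (G : KPartite k) → (Fin k → Fin (KPartite.n G)) → Set
IndepTransversal {k} G X =
  (∀ i → part (X i) ≡ i) × (∀ i j → adj (X i) (X j) ≡ false)
  where open KPartite G

cutEdges : {k : ℕ} → (G : KPartite k) → (Fin k → Fin (KPartite.n G)) → ℕ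
cutEdges {k} G X =
  sumFin k (λ i → countFin n (λ y → adj (X i) y ∧ not (inX y)))
  where
  open KPartite G
  inX : Fin n → Bool
  inX y = anyFin k (λ j → ⌊ X j ≟ y ⌋)

AlphaValue : ℕ → ℕ → ℕ → Set
AlphaValue k r a =
  Σ (KPartite k) λ G → Σ (Fin k → Fin (KPartite.n G)) λ X →
    PartiteSaturated r G × IndepTransversal G X × cutEdges G X ≡ a

-- b is the number of vertices of some K_r-free k-partite graph in which,
-- after deleting any i parts, a K_{r-1} remains.
BetaValue : ℕ → ℕ → ℕ → ℕ → Set
BetaValue i k r b =
  Σ (KPartite k) λ G →
    ¬ HasClique (KPartite.adj G) r ×
    (∀ (S : Subset k) → ∣ S ∣ ≡ i →
       Σ (Fin (r Data.Nat.∸ 1) → Fin (KPartite.n G)) λ f →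
         (∀ j → KPartite.part G (f j) ∉ S) ×
         (∀ j j′ → j ≢ j′ → KPartite.adj G (f j) (f j′) ≡ true)) ×
    KPartite.n G ≡ b

IsMin : (ℕ → Set) → ℕ → Set
IsMin P m = P m × (∀ x → P x → m ≤ x)

IsAlpha : ℕ → ℕ → ℕ → Set
IsAlpha k r = IsMin (AlphaValue k r)

IsBeta : ℕ → ℕ → ℕ → ℕ → Set
IsBeta i k r = IsMin (BetaValue i k r)

module Submission where

-- Both bounds hold for every r = s + 2 ≥ 2 and come from two constructions.
--
-- Lower bound.  Let G be K_r-partite-saturated with independent transversal
-- X = {x₁, …, x_k}.  The neighbourhood N(xᵢ) induces a (k-1)-partite graph
-- (parts of G other than i) which is K_{r-1}-free, since xᵢ extends any clique
-- of it.  For j ≠ i, adding the admissible non-edge xᵢxⱼ creates a K_r whose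
-- other r-2 vertices are common neighbours of xᵢ and xⱼ: a K_{r-2} in N(xᵢ)
-- avoiding part j.  So deg(xᵢ) ≥ β₁(k-1, r-1), and as N(xᵢ) misses X,
-- e(X, V∖X) = Σᵢ deg(xᵢ) ≥ k β₁(k-1, r-1).
--
-- Upper bound.  Let H witness β₂(k, r-1).  The cone over H adds one apex xᵢ
-- per part i, joined to every vertex of H outside part i.  It is K_r-free, the
-- apices are independent, and adding xᵢxⱼ creates a K_r (from a K_{r-2} of H
-- avoiding parts i and j).  Saturating the cone greedily keeps all of this,
-- and every edge from xᵢ to V∖X goes to a vertex of H outside part i, so
-- α(k, r) ≤ e(X, V∖X) ≤ (k-1)|H|.

open import Defs
open import Data.Nat using (ℕ; _≤_; _*_; _∸_)
open import Data.Product using (_×_)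

open import Data.Nat using (zero; suc; _+_; z≤n; s≤s)
import Data.Nat.Properties as ℕₚ
open import Algebra.Properties.CommutativeSemigroup ℕₚ.+-commutativeSemigroup using () renaming (interchange to +-interchange)
open import Data.Bool using (Bool; true; false; _∧_; _∨_; not; T)
import Data.Bool.Properties as Boolₚ
open import Data.Fin using (Fin; zero; suc; _≟_; punchIn; punchOut; splitAt; join; _↑ˡ_; _↑ʳ_)
import Data.Fin.Properties as Finₚ
open import Data.Fin.Subset using (Subset; _∈_; _∉_; ∣_∣; inside; outside; ⁅_⁆)
import Data.Fin.Subset.Properties as Subsetₚ
open import Data.Vec.Base using ([]; _∷_; here; there)
open import Data.Product using (Σ; ∃; _,_; proj₁; proj₂)
open import Data.Sum using (_⊎_; inj₁; inj₂)
open import Data.Empty using (⊥; ⊥-elim)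
open import Data.Unit using (tt)
open import Data.List using (List; []; _∷_; allFin; cartesianProduct)
open import Data.List.Membership.Propositional using () renaming (_∈_ to _∈ₗ_)
open import Data.List.Membership.Propositional.Properties using (∈-allFin; ∈-cartesianProduct⁺)
open import Data.List.Relation.Unary.Any using (here; there)
open import Relation.Nullary using (¬_; Dec; yes; no; contradiction)
open import Relation.Nullary.Decidable using (⌊_⌋; map′; ¬?; _→-dec_; _×-dec_; dec-true; dec-false; isYes≗does; toWitness)
open import Relation.Binary.PropositionalEquality

true≢false : ∀ {b} → b ≡ true → b ≡ false → ⊥
true≢false refl ()

≟-sound : ∀ {n} {x y : Fin n} → ⌊ x ≟ y ⌋ ≡ true → x ≡ y
≟-sound h = toWitness (subst T (sym h) tt)

≟-refl : ∀ {n} (x : Fin n) → ⌊ x ≟ x ⌋ ≡ true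
≟-refl x = trans (isYes≗does (x ≟ x)) (dec-true (x ≟ x) refl)

≟-≢ : ∀ {n} {x y : Fin n} → x ≢ y → ⌊ x ≟ y ⌋ ≡ false
≟-≢ {x = x} {y} x≢y = trans (isYes≗does (x ≟ y)) (dec-false (x ≟ y) x≢y)

∧-split : ∀ {b c} → b ∧ c ≡ true → b ≡ true × c ≡ true
∧-split {true} {true} _ = refl , refl

ind : Bool → ℕ
ind true  = 1
ind false = 0

ind-mono : ∀ {b c} → (b ≡ true → c ≡ true) → ind b ≤ ind c
ind-mono {false} h = z≤n
ind-mono {true}  h rewrite h refl = ℕₚ.≤-refl

countFin-suc : ∀ m (p : Fin (suc m) → Bool) →
  countFin (suc m) p ≡ ind (p zero) + countFin m (λ i → p (suc i))
countFin-suc m p with p zero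
... | true  = refl
... | false = refl

countFin-as-sum : ∀ m (p : Fin m → Bool) → countFin m p ≡ sumFin m (λ i → ind (p i))
countFin-as-sum zero    p = refl
countFin-as-sum (suc m) p =
  trans (countFin-suc m p) (cong (ind (p zero) +_) (countFin-as-sum m (λ i → p (suc i))))

sumFin-cong : ∀ m {f g : Fin m → ℕ} → (∀ i → f i ≡ g i) → sumFin m f ≡ sumFin m g
sumFin-cong zero    e = refl
sumFin-cong (suc m) e = cong₂ _+_ (e zero) (sumFin-cong m (λ i → e (suc i)))

sumFin-mono : ∀ m {f g : Fin m → ℕ} → (∀ i → f i ≤ g i) → sumFin m f ≤ sumFin m g
sumFin-mono zero    e = z≤n
sumFin-mono (suc m) e = ℕₚ.+-mono-≤ (e zero) (sumFin-mono m (λ i → e (suc i)))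

sumFin-const : ∀ m c → sumFin m (λ _ → c) ≡ m * c
sumFin-const zero    c = refl
sumFin-const (suc m) c = cong (c +_) (sumFin-const m c)

sumFin-split : ∀ k m (f : Fin (k + m) → ℕ) →
  sumFin (k + m) f ≡ sumFin k (λ i → f (i ↑ˡ m)) + sumFin m (λ v → f (k ↑ʳ v))
sumFin-split zero    m f = refl
sumFin-split (suc k) m f =
  trans (cong (f zero +_) (sumFin-split k m (λ i → f (suc i)))) (sym (ℕₚ.+-assoc (f zero) _ _))

sumFin-+ : ∀ m (f g : Fin m → ℕ) → sumFin m (λ i → f i + g i) ≡ sumFin m f + sumFin m g
sumFin-+ zero    f g = refl
sumFin-+ (suc m) f g =
  trans (cong (f zero + g zero +_) (sumFin-+ m (λ i → f (suc i)) (λ i → g (suc i))))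
        (+-interchange (f zero) (g zero) _ _)

sumFin-swap : ∀ a b (f : Fin a → Fin b → ℕ) →
  sumFin a (λ i → sumFin b (f i)) ≡ sumFin b (λ j → sumFin a (λ i → f i j))
sumFin-swap zero    b f = trans (sym (ℕₚ.*-zeroʳ b)) (sym (sumFin-const b 0))
sumFin-swap (suc a) b f =
  trans (cong (sumFin b (f zero) +_) (sumFin-swap a b (λ i → f (suc i))))
        (sym (sumFin-+ b (f zero) (λ j → sumFin a (λ i → f (suc i) j))))

count-mono : ∀ m (p q : Fin m → Bool) → (∀ i → p i ≡ true → q i ≡ true) → countFin m p ≤ countFin m q
count-mono zero    p q h = z≤n
count-mono (suc m) p q h
  rewrite countFin-suc m p | countFin-suc m q =
  ℕₚ.+-mono-≤ (ind-mono (h zero)) (count-mono m _ _ (λ i → h (suc i)))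

countFin-cong : ∀ m {p q : Fin m → Bool} → (∀ i → p i ≡ q i) → countFin m p ≡ countFin m q
countFin-cong m {p} {q} e = begin
  countFin m p                  ≡⟨ countFin-as-sum m p ⟩
  sumFin m (λ i → ind (p i))    ≡⟨ sumFin-cong m (λ i → cong ind (e i)) ⟩
  sumFin m (λ i → ind (q i))    ≡⟨ sym (countFin-as-sum m q) ⟩
  countFin m q                  ∎
  where open ≡-Reasoning

count-none : ∀ m (p : Fin m → Bool) → (∀ i → p i ≡ false) → countFin m p ≡ 0
count-none zero    p none = refl
count-none (suc m) p none
  rewrite countFin-suc m p | none zero = count-none m (λ i → p (suc i)) (λ i → none (suc i))

count-≢ : ∀ k (p : Fin k) → countFin k (λ i → not ⌊ p ≟ i ⌋) ≡ k ∸ 1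
count-≢ (suc k) zero = trans (countFin-as-sum k _) (trans (sumFin-const k 1) (ℕₚ.*-identityʳ k))
count-≢ (suc (suc k)) (suc p) =
  cong suc (trans (countFin-cong (suc k) (λ i → cong not (≟-suc p i))) (count-≢ (suc k) p))
  where
  ≟-suc : ∀ {n} (p i : Fin n) → ⌊ suc p ≟ suc i ⌋ ≡ ⌊ p ≟ i ⌋
  ≟-suc p i with p ≟ i
  ... | yes _ = refl
  ... | no  _ = refl

record Enumeration {n} (p : Fin n → Bool) (c : ℕ) : Set where
  field
    elem      : Fin c → Fin n
    sound     : ∀ z → p (elem z) ≡ true
    complete  : ∀ y → p y ≡ true → Σ (Fin c) λ z → elem z ≡ y

enumerate : ∀ n (p : Fin n → Bool) → Enumeration p (countFin n p)
enumerate zero p = record { elem = λ () ; sound = λ () ; complete = λ () }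
enumerate (suc n) p with p zero in eq | enumerate n (λ i → p (suc i))
... | true | E = record { elem = elem′ ; sound = sound′ ; complete = complete′ }
  where
  open Enumeration E
  elem′ : Fin (suc (countFin n (λ i → p (suc i)))) → Fin (suc n)
  elem′ zero    = zero
  elem′ (suc z) = suc (elem z)
  sound′ : ∀ z → p (elem′ z) ≡ true
  sound′ zero    = eq
  sound′ (suc z) = sound z
  complete′ : ∀ y → p y ≡ true → Σ _ λ z → elem′ z ≡ y
  complete′ zero    _ = zero , refl
  complete′ (suc y) h = let z , e = complete y h in suc z , cong suc e
... | false | E = record
  { elem = λ z → suc (elem z) ; sound = sound ; complete = complete′ }
  where
  open Enumeration E
  complete′ : ∀ y → p y ≡ true → Σ _ λ z → suc (elem z) ≡ y
  complete′ zero    h = contradiction (trans (sym h) eq) λ ()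
  complete′ (suc y) h = let z , e = complete y h in z , cong suc e

anyFin-witness : ∀ m (q : Fin m → Bool) → anyFin m q ≡ true → Σ (Fin m) λ i → q i ≡ true
anyFin-witness (suc m) q h with q zero in eq
... | true  = zero , eq
... | false = let i , e = anyFin-witness m (λ i → q (suc i)) h in suc i , e

anyFin-intro : ∀ m (q : Fin m → Bool) i → q i ≡ true → anyFin m q ≡ true
anyFin-intro (suc m) q zero    h rewrite h = refl
anyFin-intro (suc m) q (suc i) h rewrite anyFin-intro m (λ j → q (suc j)) i h = Boolₚ.∨-zeroʳ (q zero)

size-zero : ∀ {n} (S : Subset n) → ∣ S ∣ ≡ 0 → ∀ x → x ∉ S
size-zero (outside ∷ S) c (suc x) (there m) = size-zero S c x m

size-one : ∀ {n} (S : Subset n) → ∣ S ∣ ≡ 1 → Σ (Fin n) λ j → ∀ x → x ∈ S → x ≡ j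
size-one (inside ∷ S) c = zero , member
  where
  member : ∀ x → x ∈ (inside ∷ S) → x ≡ zero
  member zero    _         = refl
  member (suc x) (there m) = contradiction m (size-zero S (ℕₚ.suc-injective c) x)
size-one (outside ∷ S) c = let j , member = size-one S c in suc j , λ { (suc x) (there m) → cong suc (member x m) }

pair-subset : ∀ {n} (i j : Fin n) → i ≢ j → Σ (Subset n) λ S → ∣ S ∣ ≡ 2 × i ∈ S × j ∈ S
pair-subset zero    zero    i≢j = contradiction refl i≢j
pair-subset zero    (suc j) _   = inside ∷ ⁅ j ⁆ , cong suc (Subsetₚ.∣⁅x⁆∣≡1 j) , here , there (Subsetₚ.x∈⁅x⁆ j)
pair-subset (suc i) zero    _   = inside ∷ ⁅ i ⁆ , cong suc (Subsetₚ.∣⁅x⁆∣≡1 i) , there (Subsetₚ.x∈⁅x⁆ i) , here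
pair-subset (suc i) (suc j) i≢j =
  let S , c , i∈S , j∈S = pair-subset i j (λ e → i≢j (cong suc e)) in outside ∷ S , c , there i∈S , there j∈S

Adj : ℕ → Set
Adj n = Fin n → Fin n → Bool

IsClique : ∀ {V : Set} {r} → (V → V → Bool) → (Fin r → V) → Set
IsClique a f = ∀ i j → i ≢ j → a (f i) (f j) ≡ true

_⊆ₑ_ : ∀ {n} → Adj n → Adj n → Set
a ⊆ₑ b = ∀ u v → a u v ≡ true → b u v ≡ true

clique-mono : ∀ {n r} {a b : Adj n} → a ⊆ₑ b → HasClique a r → HasClique b r
clique-mono a⊆b (f , clique) = f , λ i j i≢j → a⊆b _ _ (clique i j i≢j)

_◂_ : ∀ {r} {A : Set} → A → (Fin r → A) → Fin (suc r) → A
(x ◂ g) zero    = x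
(x ◂ g) (suc i) = g i

Extensional : ∀ {r n} → ((Fin r → Fin n) → Set) → Set
Extensional P = ∀ f g → (∀ i → f i ≡ g i) → P f → P g

any-map? : ∀ r {n} (P : (Fin r → Fin n) → Set) → Extensional P → (∀ f → Dec (P f)) →
  Dec (Σ (Fin r → Fin n) P)
any-map? zero P ext P? = map′ (λ p → (λ ()) , p) restrict (P? (λ ()))
  where
  restrict : Σ _ P → P (λ ())
  restrict (f , p) = ext f (λ ()) (λ ()) p
any-map? (suc r) P ext P? = map′ build split
  (Finₚ.any? λ x → any-map? r (λ g → P (x ◂ g)) (ext-tail x) (λ g → P? (x ◂ g)))
  where
  ext-tail : ∀ x → Extensional (λ g → P (x ◂ g))
  ext-tail x f g e = ext _ _ λ { zero → refl ; (suc i) → e i }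
  build : (∃ λ x → Σ _ λ g → P (x ◂ g)) → Σ _ P
  build (x , g , p) = x ◂ g , p
  split : Σ _ P → ∃ λ x → Σ _ λ g → P (x ◂ g)
  split (f , p) = f zero , (λ i → f (suc i)) , ext f _ (λ { zero → refl ; (suc i) → refl }) p

-- Containing a K_r is decidable; saturation needs this to choose which edges to add.
hasClique? : ∀ {n} (a : Adj n) r → Dec (HasClique a r)
hasClique? a r = any-map? r (IsClique a) ext (λ f → clique? f)
  where
  ext : Extensional (IsClique a)
  ext f g e clique i j i≢j = subst₂ (λ x y → a x y ≡ true) (e i) (e j) (clique i j i≢j)
  clique? : ∀ f → Dec (IsClique a f)
  clique? f = Finₚ.all? λ i → Finₚ.all? λ j → ¬? (i ≟ j) →-dec (a (f i) (f j) Boolₚ.≟ true)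

addEdge-keeps : ∀ {n} (a : Adj n) u v → a ⊆ₑ addEdge a u v
addEdge-keeps a u v x y e rewrite e = refl

addEdge-new : ∀ {n} (a : Adj n) u v → addEdge a u v u v ≡ true
addEdge-new a u v rewrite ≟-refl u | ≟-refl v = Boolₚ.∨-zeroʳ _

addEdge-new′ : ∀ {n} (a : Adj n) u v → addEdge a u v v u ≡ true
addEdge-new′ a u v rewrite ≟-refl u | ≟-refl v | Boolₚ.∨-zeroʳ (⌊ v ≟ u ⌋ ∧ ⌊ u ≟ v ⌋) = Boolₚ.∨-zeroʳ _

addEdge-cases : ∀ {n} (a : Adj n) u v x y → addEdge a u v x y ≡ true →
  a x y ≡ true ⊎ ((x ≡ u × y ≡ v) ⊎ (x ≡ v × y ≡ u))
addEdge-cases a u v x y h with a x y | x ≟ u | y ≟ v | x ≟ v | y ≟ u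
... | true  | _      | _      | _      | _      = inj₁ refl
... | false | yes e₁ | yes e₂ | _      | _      = inj₂ (inj₁ (e₁ , e₂))
... | false | _      | _      | yes e₁ | yes e₂ = inj₂ (inj₂ (e₁ , e₂))
... | false | no _   | _      | no _   | _      = contradiction h λ ()
... | false | no _   | _      | yes _  | no _   = contradiction h λ ()
... | false | yes _  | no _   | no _   | _      = contradiction h λ ()
... | false | yes _  | no _   | yes _  | no _   = contradiction h λ ()

addEdge-old : ∀ {n} (a : Adj n) u v x y → addEdge a u v x y ≡ true → y ≢ u → y ≢ v → a x y ≡ true
addEdge-old a u v x y h y≢u y≢v with addEdge-cases a u v x y h
... | inj₁ e             = e
... | inj₂ (inj₁ (_ , e)) = contradiction e y≢v
... | inj₂ (inj₂ (_ , e)) = contradiction e y≢u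

addEdge-sym : ∀ {n} (a : Adj n) u v → (∀ x y → a x y ≡ a y x) → ∀ x y → addEdge a u v x y ≡ addEdge a u v y x
addEdge-sym a u v sym-a x y = cong₂ _∨_ (sym-a x y) (trans (Boolₚ.∨-comm (X ∧ Y) (X′ ∧ Y′))
  (cong₂ _∨_ (Boolₚ.∧-comm X′ Y′) (Boolₚ.∧-comm X Y)))
  where
  X = ⌊ x ≟ u ⌋
  Y = ⌊ y ≟ v ⌋
  X′ = ⌊ x ≟ v ⌋
  Y′ = ⌊ y ≟ u ⌋

addEdge-irrefl : ∀ {n} (a : Adj n) {u v} → (∀ x → a x x ≡ false) → u ≢ v → ∀ x → addEdge a u v x x ≢ true
addEdge-irrefl a irrefl-a u≢v x h with addEdge-cases a _ _ x x h
... | inj₁ e                   = true≢false e (irrefl-a x)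
... | inj₂ (inj₁ (refl , refl)) = u≢v refl
... | inj₂ (inj₂ (refl , refl)) = u≢v refl

addEdge-least : ∀ {n} {a b : Adj n} {u v} → (∀ x y → b x y ≡ b y x) → a ⊆ₑ b → b u v ≡ true →
  addEdge a u v ⊆ₑ b
addEdge-least {a = a} {b} {u} {v} sym-b a⊆b buv x y h with addEdge-cases a u v x y h
... | inj₁ e                   = a⊆b x y e
... | inj₂ (inj₁ (refl , refl)) = buv
... | inj₂ (inj₂ (refl , refl)) = trans (sym-b v u) buv

addEdge-mono : ∀ {n} {a b : Adj n} u v → a ⊆ₑ b → addEdge a u v ⊆ₑ addEdge b u v
addEdge-mono {a = a} {b} u v a⊆b x y h with addEdge-cases a u v x y h
... | inj₁ e                   = addEdge-keeps b u v x y (a⊆b x y e)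
... | inj₂ (inj₁ (refl , refl)) = addEdge-new b u v
... | inj₂ (inj₂ (refl , refl)) = addEdge-new′ b u v

record IndexingAvoiding {s} (α β : Fin (suc (suc s))) : Set where
  field
    index     : Fin s → Fin (suc (suc s))
    injective : ∀ l l′ → index l ≡ index l′ → l ≡ l′
    index≢α   : ∀ l → index l ≢ α
    index≢β   : ∀ l → index l ≢ β

avoid-two : ∀ {s} {α β : Fin (suc (suc s))} → α ≢ β → IndexingAvoiding α β
avoid-two {α = α} {β} α≢β = record
  { index = ι ; injective = injective ; index≢α = λ l → Finₚ.punchInᵢ≢i α _ ; index≢β = index≢β }
  where
  β′ = punchOut α≢β
  ι = λ l → punchIn α (punchIn β′ l)
  injective : ∀ l l′ → ι l ≡ ι l′ → l ≡ l′
  injective l l′ e = Finₚ.punchIn-injective β′ _ _ (Finₚ.punchIn-injective α _ _ e)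
  index≢β : ∀ l → ι l ≢ β
  index≢β l e = Finₚ.punchInᵢ≢i β′ l
    (Finₚ.punchIn-injective α _ _ (trans e (sym (Finₚ.punchIn-punchOut α≢β))))

uses-new-edge : ∀ {n r} (a : Adj n) u v (g : Fin r → Fin n) →
  IsClique (addEdge a u v) g → ¬ IsClique a g →
  Σ (Fin r) λ α → Σ (Fin r) λ β → α ≢ β × g α ≡ u × g β ≡ v
uses-new-edge a u v g clique not-clique
  with Finₚ.any? (λ α → Finₚ.any? (λ β → ¬? (α ≟ β) ×-dec (a (g α) (g β) Boolₚ.≟ false)))
... | no none = contradiction (λ α β α≢β → Boolₚ.¬-not (λ e → none (α , β , α≢β , e))) not-clique
... | yes (α , β , α≢β , non-edge) with addEdge-cases a u v (g α) (g β) (clique α β α≢β)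
...   | inj₁ edge              = contradiction non-edge (λ e → true≢false edge e)
...   | inj₂ (inj₁ (gα , gβ)) = α , β , α≢β , gα , gβ
...   | inj₂ (inj₂ (gα , gβ)) = β , α , (λ e → α≢β (sym e)) , gβ , gα

common-neighbour-clique : ∀ {n} s (a : Adj n) {u v} → (∀ x → a x x ≡ false) → u ≢ v →
  ¬ HasClique a (suc (suc s)) → HasClique (addEdge a u v) (suc (suc s)) →
  Σ (Fin s → Fin n) λ w → IsClique a w × (∀ l → a u (w l) ≡ true) × (∀ l → a v (w l) ≡ true)
common-neighbour-clique s a irrefl-a u≢v free (g , clique)
  with uses-new-edge a _ _ g clique (λ c → free (g , c))
... | α , β , α≢β , refl , refl = w , w-clique
    , (λ l → old-edge α l (λ e → index≢α l (sym e)))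
    , (λ l → old-edge β l (λ e → index≢β l (sym e)))
  where
  open IndexingAvoiding (avoid-two α≢β)
  w = λ l → g (index l)
  g-injective : ∀ x y → x ≢ y → g x ≢ g y
  g-injective x y x≢y e = addEdge-irrefl a irrefl-a u≢v (g x)
    (subst (λ z → addEdge a (g α) (g β) (g x) z ≡ true) (sym e) (clique x y x≢y))
  old-edge : ∀ x l → x ≢ index l → a (g x) (w l) ≡ true
  old-edge x l x≢ιl = addEdge-old a _ _ (g x) (w l) (clique x (index l) x≢ιl)
    (g-injective _ _ (index≢α l)) (g-injective _ _ (index≢β l))
  w-clique : IsClique a w
  w-clique l l′ l≢l′ = old-edge (index l) l′ (λ e → l≢l′ (injective l l′ e))

-- Greedy saturation: running through all pairs and adding every admissible
-- non-edge that creates no K_r turns a K_r-free k-partite graph into a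
-- K_r-partite-saturated supergraph with the same vertices and parts.
module Saturation {k : ℕ} (r : ℕ) (G : KPartite k) (free : ¬ HasClique (KPartite.adj G) r) where
  open KPartite G renaming (sym to adj-sym)

  record Valid (a : Adj n) : Set where
    field
      symmetric   : ∀ u v → a u v ≡ a v u
      irreflexive : ∀ v → a v v ≡ false
      respects    : ∀ u v → a u v ≡ true → part u ≢ part v
      clique-free : ¬ HasClique a r

  Settled : Adj n → Fin n × Fin n → Set
  Settled a (u , v) = part u ≡ part v ⊎ a u v ≡ true ⊎ HasClique (addEdge a u v) r

  settled-mono : ∀ {a b} p → a ⊆ₑ b → Settled a p → Settled b p
  settled-mono p       a⊆b (inj₁ same)          = inj₁ same
  settled-mono (u , v) a⊆b (inj₂ (inj₁ edge))   = inj₂ (inj₁ (a⊆b u v edge))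
  settled-mono (u , v) a⊆b (inj₂ (inj₂ clique)) = inj₂ (inj₂ (clique-mono (addEdge-mono u v a⊆b) clique))

  add-valid : ∀ {a u v} → Valid a → part u ≢ part v → ¬ HasClique (addEdge a u v) r → Valid (addEdge a u v)
  add-valid {a} {u} {v} V u≁v free′ = record
    { symmetric   = addEdge-sym a u v symmetric
    ; irreflexive = λ x → Boolₚ.¬-not (addEdge-irrefl a irreflexive (λ e → u≁v (cong part e)) x)
    ; respects    = respects′
    ; clique-free = free′ }
    where
    open Valid V
    respects′ : ∀ x y → addEdge a u v x y ≡ true → part x ≢ part y
    respects′ x y h with addEdge-cases a u v x y h
    ... | inj₁ e                   = respects x y e
    ... | inj₂ (inj₁ (refl , refl)) = u≁v
    ... | inj₂ (inj₂ (refl , refl)) = λ e → u≁v (sym e)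

  record Extension (a : Adj n) (ps : List (Fin n × Fin n)) : Set where
    field
      adj′     : Adj n
      valid    : Valid adj′
      contains : a ⊆ₑ adj′
      settles  : ∀ p → p ∈ₗ ps → Settled adj′ p

  settle : ∀ a → Valid a → ∀ p → Extension a (p ∷ [])
  settle a V (u , v) with part u ≟ part v | hasClique? (addEdge a u v) r
  ... | yes same | _ = record
    { adj′ = a ; valid = V ; contains = λ _ _ e → e ; settles = λ { _ (here refl) → inj₁ same } }
  ... | no _ | yes clique = record
    { adj′ = a ; valid = V ; contains = λ _ _ e → e ; settles = λ { _ (here refl) → inj₂ (inj₂ clique) } }
  ... | no u≁v | no free′ = record
    { adj′ = addEdge a u v ; valid = add-valid V u≁v free′ ; contains = addEdge-keeps a u v
    ; settles = λ { _ (here refl) → inj₂ (inj₁ (addEdge-new a u v)) } }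

  settle-all : ∀ ps a → Valid a → Extension a ps
  settle-all [] a V = record { adj′ = a ; valid = V ; contains = λ _ _ e → e ; settles = λ _ () }
  settle-all (p ∷ ps) a V = record
    { adj′ = E₂.adj′ ; valid = E₂.valid
    ; contains = λ u v e → E₂.contains u v (E₁.contains u v e)
    ; settles = λ { _ (here refl) → settled-mono p E₂.contains (E₁.settles p (here refl))
                  ; q (there q∈ps) → E₂.settles q q∈ps } }
    where
    module E₁ = Extension (settle a V p)
    module E₂ = Extension (settle-all ps E₁.adj′ E₁.valid)

  private
    E : Extension adj (cartesianProduct (allFin n) (allFin n))
    E = settle-all _ adj (record { symmetric = adj-sym ; irreflexive = irrefl ; respects = partite ; clique-free = free })
    open Extension E
    open Valid valid

  saturation : KPartite k
  saturation = record
    { n = n ; part = part ; adj = adj′ ; sym = symmetric ; irrefl = irreflexive ; partite = respects }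

  saturation-contains : adj ⊆ₑ adj′
  saturation-contains = contains

  saturation-saturated : PartiteSaturated r saturation
  saturation-saturated = clique-free , saturated
    where
    saturated : ∀ u v → part u ≢ part v → adj′ u v ≡ false → HasClique (addEdge adj′ u v) r
    saturated u v u≁v non-edge with settles (u , v) (∈-cartesianProduct⁺ (∈-allFin u) (∈-allFin v))
    ... | inj₁ same          = contradiction same u≁v
    ... | inj₂ (inj₁ edge)   = contradiction non-edge (true≢false edge)
    ... | inj₂ (inj₂ clique) = clique

inTransversal : ∀ {k n} → (Fin k → Fin n) → Fin n → Bool
inTransversal {k} X y = anyFin k (λ j → ⌊ X j ≟ y ⌋)

cutEdges-as-sum : ∀ {k} (G : KPartite k) X →
  cutEdges G X ≡ sumFin k (λ i → countFin (KPartite.n G) (λ y → KPartite.adj G (X i) y ∧ not (inTransversal X y)))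
cutEdges-as-sum G X = refl

-- The neighbourhood graph of a vertex x: the subgraph induced on N(x), which lies
-- in the k parts other than that of x (renumbered by punchOut).
module Neighbourhood {k : ℕ} (G : KPartite (suc k)) (x : Fin (KPartite.n G)) where
  open KPartite G renaming (sym to adj-sym)

  degree : ℕ
  degree = countFin n (adj x)

  open Enumeration (enumerate n (adj x)) renaming (elem to vertex) public

  other-part : ∀ z → part x ≢ part (vertex z)
  other-part z = partite x (vertex z) (sound z)

  graph : KPartite k
  graph = record
    { n       = degree
    ; part    = λ z → punchOut (other-part z)
    ; adj     = λ u v → adj (vertex u) (vertex v)
    ; sym     = λ u v → adj-sym (vertex u) (vertex v)
    ; irrefl  = λ u → irrefl (vertex u)
    ; partite = λ u v e same → partite _ _ e (Finₚ.punchOut-injective (other-part u) (other-part v) same) }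

  part-vertex : ∀ z → punchIn (part x) (KPartite.part graph z) ≡ part (vertex z)
  part-vertex z = Finₚ.punchIn-punchOut (other-part z)

  -- x extends every clique of the neighbourhood graph.
  clique-free : ∀ {s} → ¬ HasClique adj (suc s) → ¬ HasClique (KPartite.adj graph) s
  clique-free free (f , clique) = free (x ◂ (λ l → vertex (f l)) , extended)
    where
    extended : IsClique adj (x ◂ λ l → vertex (f l))
    extended zero    zero    0≢0 = contradiction refl 0≢0
    extended zero    (suc b) _   = sound (f b)
    extended (suc a) zero    _   = trans (adj-sym _ x) (sound (f a))
    extended (suc a) (suc b) a≢b = clique a b (λ e → a≢b (cong suc e))

  lift : ∀ {s} (w : Fin s → Fin n) → IsClique adj w → (∀ l → adj x (w l) ≡ true) →
    Σ (Fin s → Fin degree) λ f → IsClique (KPartite.adj graph) f × (∀ l → vertex (f l) ≡ w l)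
  lift w clique adjacent = f , f-clique , f-vertex
    where
    f = λ l → proj₁ (complete (w l) (adjacent l))
    f-vertex : ∀ l → vertex (f l) ≡ w l
    f-vertex l = proj₂ (complete (w l) (adjacent l))
    f-clique : IsClique (KPartite.adj graph) f
    f-clique l l′ l≢l′ = subst₂ (λ u v → adj u v ≡ true) (sym (f-vertex l)) (sym (f-vertex l′)) (clique l l′ l≢l′)

module LowerBound {k s : ℕ} (G : KPartite (suc k)) (X : Fin (suc k) → Fin (KPartite.n G))
  (saturated : PartiteSaturated (suc (suc s)) G) (transversal : IndepTransversal G X) where
  open KPartite G renaming (sym to adj-sym)
  open Neighbourhood G using (degree; graph; vertex; part-vertex; lift)

  -- Deleting a part j ≠ i from N(xᵢ) leaves a K_s: the common neighbours of xᵢ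
  -- and xⱼ in a K_{s+2} created by adding the admissible non-edge xᵢxⱼ.
  neighbourhood-beta : ∀ i → BetaValue 1 k (suc s) (degree (X i))
  neighbourhood-beta i = graph (X i) , Neighbourhood.clique-free G (X i) (proj₁ saturated) , robust , refl
    where
    robust : ∀ S → ∣ S ∣ ≡ 1 → Σ (Fin s → Fin (degree (X i))) λ f →
      (∀ l → KPartite.part (graph (X i)) (f l) ∉ S) × IsClique (KPartite.adj (graph (X i))) f
    robust S size = f , avoids , f-clique
      where
      j′ = proj₁ (size-one S size)
      j  = punchIn (part (X i)) j′
      parts-differ : part (X i) ≢ part (X j)
      parts-differ e = Finₚ.punchInᵢ≢i (part (X i)) j′ (trans (sym (proj₁ transversal j)) (sym e))
      common = common-neighbour-clique s adj irrefl (λ e → parts-differ (cong part e)) (proj₁ saturated)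
        (proj₂ saturated (X i) (X j) parts-differ (proj₂ transversal i j))
      w = proj₁ common
      lifted = lift (X i) w (proj₁ (proj₂ common)) (proj₁ (proj₂ (proj₂ common)))
      f = proj₁ lifted
      f-clique = proj₁ (proj₂ lifted)
      avoids : ∀ l → KPartite.part (graph (X i)) (f l) ∉ S
      avoids l f∈S = partite (X j) (w l) (proj₂ (proj₂ (proj₂ common)) l) (begin
        part (X j)                                              ≡⟨ proj₁ transversal j ⟩
        punchIn (part (X i)) j′                                 ≡⟨ cong (punchIn (part (X i))) (sym (proj₂ (size-one S size) _ f∈S)) ⟩
        punchIn (part (X i)) (KPartite.part (graph (X i)) (f l)) ≡⟨ part-vertex (X i) (f l) ⟩
        part (vertex (X i) (f l))                               ≡⟨ cong part (proj₂ (proj₂ lifted) l) ⟩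
        part (w l)                                              ∎)
        where open ≡-Reasoning

  -- Neighbours of xᵢ lie outside the independent set X.
  degree-bound : ∀ i → degree (X i) ≤ countFin n (λ y → adj (X i) y ∧ not (inTransversal X y))
  degree-bound i = count-mono n _ _ not-in-X
    where
    not-in-X : ∀ y → adj (X i) y ≡ true → adj (X i) y ∧ not (inTransversal X y) ≡ true
    not-in-X y edge with inTransversal X y in member
    ... | false = trans (Boolₚ.∧-identityʳ _) edge
    ... | true  = let j , e = anyFin-witness (suc k) (λ j → ⌊ X j ≟ y ⌋) member in
      ⊥-elim (true≢false (subst (λ z → adj (X i) z ≡ true) (sym (≟-sound e)) edge) (proj₂ transversal i j))

  lower-bound : ∀ b → (∀ x → BetaValue 1 k (suc s) x → b ≤ x) → suc k * b ≤ cutEdges G X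
  lower-bound b minimal = begin
    suc k * b                       ≡⟨ sym (sumFin-const (suc k) b) ⟩
    sumFin (suc k) (λ _ → b)        ≤⟨ sumFin-mono (suc k) (λ i → minimal _ (neighbourhood-beta i)) ⟩
    sumFin (suc k) (λ i → degree (X i)) ≤⟨ sumFin-mono (suc k) degree-bound ⟩
    sumFin (suc k) (λ i → countFin n (λ y → adj (X i) y ∧ not (inTransversal X y)))
                                    ≡⟨ sym (cutEdges-as-sum G X) ⟩
    cutEdges G X                    ∎
    where open ℕₚ.≤-Reasoning

count-split : ∀ k m (p : Fin (k + m) → Bool) →
  countFin (k + m) p ≡ countFin k (λ i → p (i ↑ˡ m)) + countFin m (λ v → p (k ↑ʳ v))
count-split k m p = begin
  countFin (k + m) p
    ≡⟨ countFin-as-sum (k + m) p ⟩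
  sumFin (k + m) (λ y → ind (p y))
    ≡⟨ sumFin-split k m (λ y → ind (p y)) ⟩
  sumFin k (λ i → ind (p (i ↑ˡ m))) + sumFin m (λ v → ind (p (k ↑ʳ v)))
    ≡⟨ sym (cong₂ _+_ (countFin-as-sum k _) (countFin-as-sum m _)) ⟩
  countFin k (λ i → p (i ↑ˡ m)) + countFin m (λ v → p (k ↑ʳ v)) ∎
  where open ≡-Reasoning

-- The cone over a k-partite graph H on m vertices: its vertices are Fin (k + m),
-- the first k being apices x₁, …, x_k with xᵢ in part i, each xᵢ joined to every
-- vertex of H outside part i; the apices are pairwise non-adjacent.
module Cone {k : ℕ} (H : KPartite k) where
  open KPartite H using () renaming (n to m; part to partH; adj to adjH)

  adj⊎ : Fin k ⊎ Fin m → Fin k ⊎ Fin m → Bool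
  adj⊎ (inj₁ i) (inj₁ j) = false
  adj⊎ (inj₁ i) (inj₂ v) = not ⌊ partH v ≟ i ⌋
  adj⊎ (inj₂ v) (inj₁ i) = not ⌊ partH v ≟ i ⌋
  adj⊎ (inj₂ u) (inj₂ v) = adjH u v

  part⊎ : Fin k ⊎ Fin m → Fin k
  part⊎ (inj₁ i) = i
  part⊎ (inj₂ v) = partH v

  sym⊎ : ∀ x y → adj⊎ x y ≡ adj⊎ y x
  sym⊎ (inj₁ i) (inj₁ j) = refl
  sym⊎ (inj₁ i) (inj₂ v) = refl
  sym⊎ (inj₂ v) (inj₁ i) = refl
  sym⊎ (inj₂ u) (inj₂ v) = KPartite.sym H u v

  irrefl⊎ : ∀ x → adj⊎ x x ≡ false
  irrefl⊎ (inj₁ i) = refl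
  irrefl⊎ (inj₂ v) = KPartite.irrefl H v

  apex-edge : ∀ i v → adj⊎ (inj₁ i) (inj₂ v) ≡ true → partH v ≢ i
  apex-edge i v h e rewrite e | ≟-refl i = contradiction h λ ()

  partite⊎ : ∀ x y → adj⊎ x y ≡ true → part⊎ x ≢ part⊎ y
  partite⊎ (inj₁ i) (inj₂ v) h e = apex-edge i v h (sym e)
  partite⊎ (inj₂ v) (inj₁ i) h e = apex-edge i v h e
  partite⊎ (inj₂ u) (inj₂ v) h   = KPartite.partite H u v h

  graph : KPartite k
  graph = record
    { n       = k + m
    ; part    = λ y → part⊎ (splitAt k y)
    ; adj     = λ y z → adj⊎ (splitAt k y) (splitAt k z)
    ; sym     = λ y z → sym⊎ (splitAt k y) (splitAt k z)
    ; irrefl  = λ y → irrefl⊎ (splitAt k y)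
    ; partite = λ y z → partite⊎ (splitAt k y) (splitAt k z) }

  apex : Fin k → Fin (k + m)
  apex i = i ↑ˡ m

  apex-part : ∀ i → KPartite.part graph (apex i) ≡ i
  apex-part i rewrite Finₚ.splitAt-↑ˡ k i m = refl

  apex-neighbour : ∀ i y → adj⊎ (inj₁ i) y ≡ true → Σ (Fin m) λ v → y ≡ inj₂ v
  apex-neighbour i (inj₂ v) _ = v , refl

  -- All but at most one vertex of a clique of adj⊎ lie in H, since the apices
  -- are independent: an injective ι picks s of its s + 1 vertices, all in H.
  vertices-in-H : ∀ s (f : Fin (suc s) → Fin k ⊎ Fin m) → IsClique adj⊎ f →
    Σ (Fin s → Fin (suc s)) λ ι → (∀ l l′ → ι l ≡ ι l′ → l ≡ l′) ×
      Σ (Fin s → Fin m) λ g → ∀ l → f (ι l) ≡ inj₂ (g l)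
  vertices-in-H s f clique with f zero in eq
  ... | inj₁ i = suc , (λ l l′ e → Finₚ.suc-injective e) , g , g-eq
    where
    neighbour : ∀ l → Σ (Fin m) λ v → f (suc l) ≡ inj₂ v
    neighbour l = apex-neighbour i _ (subst (λ x → adj⊎ x (f (suc l)) ≡ true) eq (clique zero (suc l) λ ()))
    g = λ l → proj₁ (neighbour l)
    g-eq = λ l → proj₂ (neighbour l)
  vertices-in-H zero    f clique | inj₂ v = (λ ()) , (λ ()) , (λ ()) , (λ ())
  vertices-in-H (suc s) f clique | inj₂ v
    with vertices-in-H s (λ l → f (suc l)) (λ l l′ l≢l′ → clique (suc l) (suc l′) (λ e → l≢l′ (Finₚ.suc-injective e)))
  ... | ι , ι-injective , g , g-eq = zero ◂ (λ l → suc (ι l)) , injective , v ◂ g , λ { zero → eq ; (suc l) → g-eq l }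
    where
    injective : ∀ l l′ → (zero ◂ (λ l → suc (ι l))) l ≡ (zero ◂ (λ l → suc (ι l))) l′ → l ≡ l′
    injective zero    zero     _ = refl
    injective (suc l) (suc l′) e = cong suc (ι-injective l l′ (Finₚ.suc-injective e))

  clique-free : ∀ {s} → ¬ HasClique adjH (suc s) → ¬ HasClique (KPartite.adj graph) (suc (suc s))
  clique-free {s} free (f , clique) with vertices-in-H (suc s) (λ l → splitAt k (f l)) clique
  ... | ι , ι-injective , g , g-eq = free (g , g-clique)
    where
    g-clique : IsClique adjH g
    g-clique l l′ l≢l′ = subst₂ (λ x y → adj⊎ x y ≡ true) (g-eq l) (g-eq l′)
      (clique (ι l) (ι l′) (λ e → l≢l′ (ι-injective l l′ e)))

  apex-pair-clique : ∀ {s} i j → i ≢ j → (w : Fin s → Fin m) → IsClique adjH w →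
    (∀ l → partH (w l) ≢ i) → (∀ l → partH (w l) ≢ j) →
    HasClique (addEdge (KPartite.adj graph) (apex i) (apex j)) (suc (suc s))
  apex-pair-clique {s} i j i≢j w w-clique ≢i ≢j = vertex , clique
    where
    a  = KPartite.adj graph
    a⁺ = addEdge a (apex i) (apex j)
    vertex : Fin (suc (suc s)) → Fin (k + m)
    vertex = apex i ◂ (apex j ◂ λ l → k ↑ʳ w l)
    apex-to-H : ∀ i l → partH (w l) ≢ i → a (apex i) (k ↑ʳ w l) ≡ true
    apex-to-H i l ≢ rewrite Finₚ.splitAt-↑ˡ k i m | Finₚ.splitAt-↑ʳ k m (w l) = cong not (≟-≢ ≢)
    H-to-apex : ∀ i l → partH (w l) ≢ i → a (k ↑ʳ w l) (apex i) ≡ true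
    H-to-apex i l ≢ = trans (KPartite.sym graph _ _) (apex-to-H i l ≢)
    H-to-H : ∀ l l′ → l ≢ l′ → a (k ↑ʳ w l) (k ↑ʳ w l′) ≡ true
    H-to-H l l′ l≢l′ rewrite Finₚ.splitAt-↑ʳ k m (w l) | Finₚ.splitAt-↑ʳ k m (w l′) = w-clique l l′ l≢l′
    old : ∀ x y → a x y ≡ true → a⁺ x y ≡ true
    old = addEdge-keeps a (apex i) (apex j)
    clique : IsClique a⁺ vertex
    clique zero          zero           0≢0 = contradiction refl 0≢0
    clique zero          (suc zero)     _   = addEdge-new a (apex i) (apex j)
    clique zero          (suc (suc l))  _   = old _ _ (apex-to-H i l (≢i l))
    clique (suc zero)    zero           _   = addEdge-new′ a (apex i) (apex j)
    clique (suc zero)    (suc zero)     1≢1 = contradiction refl 1≢1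
    clique (suc zero)    (suc (suc l))  _   = old _ _ (apex-to-H j l (≢j l))
    clique (suc (suc l)) zero           _   = old _ _ (H-to-apex i l (≢i l))
    clique (suc (suc l)) (suc zero)     _   = old _ _ (H-to-apex j l (≢j l))
    clique (suc (suc l)) (suc (suc l′)) n   = old _ _ (H-to-H l l′ (λ e → n (cong (λ z → suc (suc z)) e)))

  H-outside : Fin k → Fin k ⊎ Fin m → Bool
  H-outside i (inj₁ _) = false
  H-outside i (inj₂ v) = not ⌊ partH v ≟ i ⌋

  apex-degree-bound : (b : Adj (k + m)) →
    (∀ y z → b y z ≡ true → KPartite.part graph y ≢ KPartite.part graph z) → ∀ i →
    countFin (k + m) (λ y → b (apex i) y ∧ not (inTransversal apex y)) ≤ countFin m (λ v → not ⌊ partH v ≟ i ⌋)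
  apex-degree-bound b respects i = begin
    countFin (k + m) (λ y → b (apex i) y ∧ not (inTransversal apex y))
      ≤⟨ count-mono (k + m) _ _ neighbour-outside ⟩
    countFin (k + m) (λ y → H-outside i (splitAt k y))
      ≡⟨ count-split k m _ ⟩
    countFin k (λ j → H-outside i (splitAt k (apex j))) + countFin m (λ v → H-outside i (splitAt k (k ↑ʳ v)))
      ≡⟨ cong₂ _+_ (count-none k _ (λ j → cong (H-outside i) (Finₚ.splitAt-↑ˡ k j m)))
                   (countFin-cong m (λ v → cong (H-outside i) (Finₚ.splitAt-↑ʳ k m v))) ⟩
    countFin m (λ v → not ⌊ partH v ≟ i ⌋) ∎
    where
    open ℕₚ.≤-Reasoning
    neighbour-outside : ∀ y → b (apex i) y ∧ not (inTransversal apex y) ≡ true → H-outside i (splitAt k y) ≡ true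
    neighbour-outside y h with splitAt k y in split-y
    ... | inj₁ j = contradiction (proj₂ (∧-split h)) (Boolₚ.not-¬ (cong not is-apex))
      where
      y≡apex : y ≡ apex j
      y≡apex = trans (sym (Finₚ.join-splitAt k m y)) (cong (join k m) split-y)
      is-apex : inTransversal apex y ≡ true
      is-apex = anyFin-intro k _ j (subst (λ z → ⌊ apex j ≟ z ⌋ ≡ true) (sym y≡apex) (≟-refl (apex j)))
    ... | inj₂ v = cong not (≟-≢ λ e → respects (apex i) y (proj₁ (∧-split h))
                    (trans (apex-part i) (trans (sym e) (sym (cong part⊎ split-y)))))

  -- Summing over the apices: each vertex of H lies outside k - 1 of the parts,
  -- so e(X, V∖X) ≤ (k - 1) m.
  cut-bound : (b : Adj (k + m)) →
    (∀ y z → b y z ≡ true → KPartite.part graph y ≢ KPartite.part graph z) →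
    sumFin k (λ i → countFin (k + m) (λ y → b (apex i) y ∧ not (inTransversal apex y))) ≤ (k ∸ 1) * m
  cut-bound b respects = begin
    sumFin k (λ i → countFin (k + m) (λ y → b (apex i) y ∧ not (inTransversal apex y)))
      ≤⟨ sumFin-mono k (apex-degree-bound b respects) ⟩
    sumFin k (λ i → countFin m (λ v → not ⌊ partH v ≟ i ⌋))
      ≡⟨ sumFin-cong k (λ i → countFin-as-sum m _) ⟩
    sumFin k (λ i → sumFin m (λ v → ind (not ⌊ partH v ≟ i ⌋)))
      ≡⟨ sumFin-swap k m _ ⟩
    sumFin m (λ v → sumFin k (λ i → ind (not ⌊ partH v ≟ i ⌋)))
      ≡⟨ sumFin-cong m (λ v → trans (sym (countFin-as-sum k _)) (count-≢ k (partH v))) ⟩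
    sumFin m (λ _ → k ∸ 1)
      ≡⟨ sumFin-const m (k ∸ 1) ⟩
    m * (k ∸ 1)
      ≡⟨ ℕₚ.*-comm m (k ∸ 1) ⟩
    (k ∸ 1) * m ∎
    where open ℕₚ.≤-Reasoning

module UpperBound {k s : ℕ} (H : KPartite k) (free : ¬ HasClique (KPartite.adj H) (suc s))
  (robust : ∀ (S : Subset k) → ∣ S ∣ ≡ 2 →
     Σ (Fin s → Fin (KPartite.n H)) λ f → (∀ l → KPartite.part H (f l) ∉ S) × IsClique (KPartite.adj H) f) where
  open Cone H
  open Saturation (suc (suc s)) graph (clique-free free)

  -- Adding xᵢxⱼ to the cone creates a K_{s+2}, via a K_s of H avoiding parts i and j.
  apex-pair-blocked : ∀ i j → i ≢ j → HasClique (addEdge (KPartite.adj graph) (apex i) (apex j)) (suc (suc s))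
  apex-pair-blocked i j i≢j = apex-pair-clique i j i≢j w w-clique
    (λ l e → avoids l (subst (_∈ S) (sym e) i∈S)) (λ l e → avoids l (subst (_∈ S) (sym e) j∈S))
    where
    pair = pair-subset i j i≢j
    S = proj₁ pair
    i∈S = proj₁ (proj₂ (proj₂ pair))
    j∈S = proj₂ (proj₂ (proj₂ pair))
    clique = robust S (proj₁ (proj₂ pair))
    w = proj₁ clique
    avoids = proj₁ (proj₂ clique)
    w-clique = proj₂ (proj₂ clique)

  -- The apices stay independent in the saturation, since an edge xᵢxⱼ would complete a K_{s+2}.
  apices-transversal : IndepTransversal saturation apex
  apices-transversal = apex-part , independent
    where
    independent : ∀ i j → KPartite.adj saturation (apex i) (apex j) ≡ false
    independent i j with i ≟ j
    ... | yes refl = KPartite.irrefl saturation (apex i)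
    ... | no  i≢j  = Boolₚ.¬-not λ edge → proj₁ saturation-saturated
      (clique-mono (addEdge-least (KPartite.sym saturation) saturation-contains edge) (apex-pair-blocked i j i≢j))

  upper-bound : Σ ℕ λ c → AlphaValue k (suc (suc s)) c × c ≤ (k ∸ 1) * KPartite.n H
  upper-bound = cutEdges saturation apex
    , (saturation , apex , saturation-saturated , apices-transversal , refl)
    , cut-bound (KPartite.adj saturation) (KPartite.partite saturation)

proposition3p1 : ∀ (k r : ℕ) → 3 ≤ r → r ≤ k →
    ∀ (a b₁ b₂ : ℕ) → IsAlpha k r a → IsBeta 1 (k ∸ 1) (r ∸ 1) b₁ → IsBeta 2 k (r ∸ 1) b₂ →
      (k * b₁ ≤ a) × (a ≤ (k ∸ 1) * b₂)
proposition3p1 (suc k) (suc (suc (suc t))) (s≤s (s≤s (s≤s _))) (s≤s _) a b₁ b₂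
  ((G , X , saturated , transversal , refl) , α-minimal) (_ , β₁-minimal) ((H , free , robust , refl) , _) =
  LowerBound.lower-bound G X saturated transversal b₁ β₁-minimal ,
  ℕₚ.≤-trans (α-minimal _ (proj₁ (proj₂ upper))) (proj₂ (proj₂ upper))
  where
  upper = UpperBound.upper-bound H free robust
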